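{- In natural deduction for HyLL (as described in the context): (1) If $\Gamma;\Delta\vdash A@u$ and $\Gamma;\Delta',A@u\vdash C@w$, then $\Gamma;\Delta,\Delta'\vdash C@w$. (2) If $\Gamma;\cdot\vdash A@u$ and $\Gamma,A@u;\Delta\vdash C@w$, then $\Gamma;\Delta\vdash C@w$.
   Context: Fix a constraint domain, i.e. a monoid $\mathcal W=\langle W,\cdot,\iota\rangle$ whose elements are called worlds. World expressions $u,v,w$ are built from world variables and elements of $W$ using $\cdot$; terms are built from term variables and function symbols. HyLL propositions are $A,B::= a\,\vec t \mid A\otimes B\mid \mathbf 1\mid A\multimap B\mid A\,\&\,B\mid\top\mid A\oplus B\mid \mathbf 0\mid\, !A\mid \forall x.A\mid\exists x.A\mid (A\ \mathrm{at}\ w)\mid \downarrow u.A\mid\forall u.A\mid \exists u.A$, with $a$ a predicate symbol applied to terms, $x$ a term variable, $u$ a world variable ($\downarrow u$, $\forall u$, $\exists u$ bind $u$). $\alpha$ ranges over variables of either kind, $\tau$ over terms or world expressions accordingly, $[\tau/\alpha]A$ is capture-avoiding substitution, and propositions are identified up to $\alpha$-conversion. A judgement is $A@w$. Hypothetical judgements have the form $\Gamma;\Delta\vdash C@w$ with $\Gamma$ a set (unrestricted context) and $\Delta$ a multiset (linear context) of judgements. The derivable ones are generated by the rules: hyp: $\Gamma;A@w\vdash A@w$; hyp!: $\Gamma,A@w;\cdot\vdash A@w$; $\otimes$I: from $\Gamma;\Delta\vdash A@w$ and $\Gamma;\Delta'\vdash B@w$ infer $\Gamma;\Delta,\Delta'\vdash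 A\otimes B@w$; $\otimes$E: from $\Gamma;\Delta\vdash A\otimes B@w$ and $\Gamma;\Delta',A@w,B@w\vdash C@w'$ infer $\Gamma;\Delta,\Delta'\vdash C@w'$; $\mathbf1$I: $\Gamma;\cdot\vdash\mathbf 1@w$; $\mathbf 1$E: from $\Gamma;\Delta\vdash \mathbf1@w$ and $\Gamma;\Delta'\vdash C@w'$ infer $\Gamma;\Delta,\Delta'\vdash C@w'$; $\multimap$I: from $\Gamma;\Delta,A@w\vdash B@w$ infer $\Gamma;\Delta\vdash A\multimap B@w$; $\multimap$E: from $\Gamma;\Delta\vdash A\multimap B@w$ and $\Gamma;\Delta'\vdash A@w$ infer $\Gamma;\Delta,\Delta'\vdash B@w$; $\&$I: from $\Gamma;\Delta\vdash A@w$ and $\Gamma;\Delta\vdash B@w$ infer $\Gamma;\Delta\vdash A\&B@w$; $\&$E$_i$: from $\Gamma;\Delta\vdash A_1\&A_2@w$ infer $\Gamma;\Delta\vdash A_i@w$; $\oplus$I$_i$: from $\Gamma;\Delta\vdash A_i@w$ infer $\Gamma;\Delta\vdash A_1\oplus A_2@w$; $\oplus$E: from $\Gamma;\Delta\vdash A\oplus B@w$, $\Gamma;\Delta',A@w\vdash C@w'$, $\Gamma;\Delta',B@w\vdash C@w'$ infer $\Gamma;\Delta,\Delta'\vdash C@w'$; $\top$I: $\Gamma;\Delta\vdash\top@w$; $\mathbf0$E: from $\Gamma;\Delta\vdash\mathbf 0@w$ infer $\Gamma;\Delta,\Delta'\vdash C@w'$; $\forall$I: from $\Gamma;\Delta\vdash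 A@w$ infer $\Gamma;\Delta\vdash\forall\alpha.A@w$ ($\alpha$ fresh for the conclusion); $\forall$E: from $\Gamma;\Delta\vdash\forall\alpha.A@w$ infer $\Gamma;\Delta\vdash[\tau/\alpha]A@w$; $\exists$I: from $\Gamma;\Delta\vdash[\tau/\alpha]A@w$ infer $\Gamma;\Delta\vdash\exists\alpha.A@w$; $\exists$E: from $\Gamma;\Delta\vdash\exists\alpha.A@w$ and $\Gamma;\Delta',A@w\vdash C@w'$ ($\alpha$ fresh for the conclusion) infer $\Gamma;\Delta,\Delta'\vdash C@w'$; !I: from $\Gamma;\cdot\vdash A@w$ infer $\Gamma;\cdot\vdash !A@w$; !E: from $\Gamma;\Delta\vdash !A@w$ and $\Gamma,A@w;\Delta'\vdash C@w'$ infer $\Gamma;\Delta,\Delta'\vdash C@w'$; at I: from $\Gamma;\Delta\vdash A@w$ infer $\Gamma;\Delta\vdash (A\ \mathrm{at}\ w)@w'$; at E: from $\Gamma;\Delta\vdash(A\ \mathrm{at}\ w)@w'$ infer $\Gamma;\Delta\vdash A@w$; $\downarrow$I: from $\Gamma;\Delta\vdash[w/u]A@w$ infer $\Gamma;\Delta\vdash\downarrow u.A@w$; $\downarrow$E: from $\Gamma;\Delta\vdash\downarrow u.A@w$ infer $\Gamma;\Delta\vdash[w/u]A@w$. -}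

module Defs where

open import Level using (Level)
open import Data.Nat using (ℕ; zero; suc)
open import Data.Fin using (Fin; zero; suc)
open import Data.Vec using (Vec; []; _∷_)
open import Data.List using (List; []; _∷_; _++_; map; [_])
open import Data.List.Membership.Propositional using (_∈_)
open import Data.List.Relation.Binary.Permutation.Propositional using (_↭_)
open import Data.Product using (_×_; _,_)
open import Algebra.Bundles using (Monoid)

record Signature : Set₁ where
  field
    FunSym    : Set
    funArity  : FunSym → ℕ
    PredSym   : Set
    predArity : PredSym → ℕ

-- Syntax is well-scoped de Bruijn: Tm m has m term variables in scope,
-- Wld k has k world variables in scope, Prop m k both.
module HyLL {c ℓ : Level} (𝒲 : Monoid c ℓ) (Sig : Signature) where
  open Signature Sig

  W : Set c
  W = Monoid.Carrier 𝒲

  data Tm (m : ℕ) : Set where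
    var : Fin m → Tm m
    fun : (f : FunSym) → Vec (Tm m) (funArity f) → Tm m

  mutual
    renTm : ∀ {m m'} → (Fin m → Fin m') → Tm m → Tm m'
    renTm ρ (var x)    = var (ρ x)
    renTm ρ (fun f ts) = fun f (renTms ρ ts)

    renTms : ∀ {m m' n} → (Fin m → Fin m') → Vec (Tm m) n → Vec (Tm m') n
    renTms ρ []       = []
    renTms ρ (t ∷ ts) = renTm ρ t ∷ renTms ρ ts

  mutual
    subTm : ∀ {m m'} → (Fin m → Tm m') → Tm m → Tm m'
    subTm σ (var x)    = σ x
    subTm σ (fun f ts) = fun f (subTms σ ts)

    subTms : ∀ {m m' n} → (Fin m → Tm m') → Vec (Tm m) n → Vec (Tm m') n
    subTms σ []       = []
    subTms σ (t ∷ ts) = subTm σ t ∷ subTms σ ts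

  liftT : ∀ {m m'} → (Fin m → Tm m') → Fin (suc m) → Tm (suc m')
  liftT σ zero    = var zero
  liftT σ (suc x) = renTm suc (σ x)

  sgT : ∀ {m} → Tm m → Fin (suc m) → Tm m
  sgT τ zero    = τ
  sgT τ (suc x) = var x

  infixl 8 _·_
  data Wld (k : ℕ) : Set c where
    wvar : Fin k → Wld k
    wel  : W → Wld k
    _·_  : Wld k → Wld k → Wld k

  subW : ∀ {k k'} → (Fin k → Wld k') → Wld k → Wld k'
  subW σ (wvar x) = σ x
  subW σ (wel a)  = wel a
  subW σ (u · v)  = subW σ u · subW σ v

  wkW : ∀ {k} → Wld k → Wld (suc k)
  wkW = subW (λ x → wvar (suc x))

  liftW : ∀ {k k'} → (Fin k → Wld k') → Fin (suc k) → Wld (suc k')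
  liftW σ zero    = wvar zero
  liftW σ (suc x) = wkW (σ x)

  sgW : ∀ {k} → Wld k → Fin (suc k) → Wld k
  sgW w zero    = w
  sgW w (suc x) = wvar x

  infixr 6 _⊗_
  infixr 5 _⊸_
  infixr 6 _&_
  infixr 6 _⊕_
  infix  7 _at_
  data Prop (m k : ℕ) : Set c where
    atom : (a : PredSym) → Vec (Tm m) (predArity a) → Prop m k
    _⊗_  : Prop m k → Prop m k → Prop m k
    𝟏    : Prop m k
    _⊸_  : Prop m k → Prop m k → Prop m k
    _&_  : Prop m k → Prop m k → Prop m k
    ⊤    : Prop m k
    _⊕_  : Prop m k → Prop m k → Prop m k
    𝟎    : Prop m k
    !_   : Prop m k → Prop m k
    ∀t   : Prop (suc m) k → Prop m k
    ∃t   : Prop (suc m) k → Prop m k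
    _at_ : Prop m k → Wld k → Prop m k
    ↓_   : Prop m (suc k) → Prop m k
    ∀w   : Prop m (suc k) → Prop m k
    ∃w   : Prop m (suc k) → Prop m k

  substT : ∀ {m m' k} → (Fin m → Tm m') → Prop m k → Prop m' k
  substT σ (atom a ts) = atom a (subTms σ ts)
  substT σ (A ⊗ B)     = substT σ A ⊗ substT σ B
  substT σ 𝟏           = 𝟏
  substT σ (A ⊸ B)     = substT σ A ⊸ substT σ B
  substT σ (A & B)     = substT σ A & substT σ B
  substT σ ⊤           = ⊤
  substT σ (A ⊕ B)     = substT σ A ⊕ substT σ B
  substT σ 𝟎           = 𝟎
  substT σ (! A)       = ! substT σ A
  substT σ (∀t A)      = ∀t (substT (liftT σ) A)
  substT σ (∃t A)      = ∃t (substT (liftT σ) A)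
  substT σ (A at w)    = substT σ A at w
  substT σ (↓ A)       = ↓ substT σ A
  substT σ (∀w A)      = ∀w (substT σ A)
  substT σ (∃w A)      = ∃w (substT σ A)

  substW : ∀ {m k k'} → (Fin k → Wld k') → Prop m k → Prop m k'
  substW σ (atom a ts) = atom a ts
  substW σ (A ⊗ B)     = substW σ A ⊗ substW σ B
  substW σ 𝟏           = 𝟏
  substW σ (A ⊸ B)     = substW σ A ⊸ substW σ B
  substW σ (A & B)     = substW σ A & substW σ B
  substW σ ⊤           = ⊤
  substW σ (A ⊕ B)     = substW σ A ⊕ substW σ B
  substW σ 𝟎           = 𝟎
  substW σ (! A)       = ! substW σ A
  substW σ (∀t A)      = ∀t (substW σ A)
  substW σ (∃t A)      = ∃t (substW σ A)
  substW σ (A at w)    = substW σ A at subW σ w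
  substW σ (↓ A)       = ↓ substW (liftW σ) A
  substW σ (∀w A)      = ∀w (substW (liftW σ) A)
  substW σ (∃w A)      = ∃w (substW (liftW σ) A)

  _[_]T : ∀ {m k} → Prop (suc m) k → Tm m → Prop m k
  A [ τ ]T = substT (sgT τ) A

  _[_]W : ∀ {m k} → Prop m (suc k) → Wld k → Prop m k
  A [ w ]W = substW (sgW w) A

  wkPT : ∀ {m k} → Prop m k → Prop (suc m) k
  wkPT = substT (λ x → var (suc x))

  wkPW : ∀ {m k} → Prop m k → Prop m (suc k)
  wkPW = substW (λ x → wvar (suc x))

  Jdg : ℕ → ℕ → Set c
  Jdg m k = Prop m k × Wld k

  -- Γ is used only through membership (a set); Δ is a multiset,
  -- realised as a list taken up to permutation (_↭_).
  Ctx : ℕ → ℕ → Set c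
  Ctx m k = List (Jdg m k)

  wkJT : ∀ {m k} → Jdg m k → Jdg (suc m) k
  wkJT (A , w) = (wkPT A , w)

  wkJW : ∀ {m k} → Jdg m k → Jdg m (suc k)
  wkJW (A , w) = (wkPW A , wkW w)

  infix 3 _⨾_⊢_＠_
  data _⨾_⊢_＠_ : {m k : ℕ} → Ctx m k → Ctx m k → Prop m k → Wld k → Set c where
    hyp  : ∀ {m k} {Γ : Ctx m k} {A w} →
           Γ ⨾ [ (A , w) ] ⊢ A ＠ w
    hyp! : ∀ {m k} {Γ : Ctx m k} {A w} →
           (A , w) ∈ Γ → Γ ⨾ [] ⊢ A ＠ w
    ⊗I   : ∀ {m k} {Γ Δ Δ₁ Δ₂ : Ctx m k} {A B w} →
           Γ ⨾ Δ₁ ⊢ A ＠ w → Γ ⨾ Δ₂ ⊢ B ＠ w → Δ ↭ Δ₁ ++ Δ₂ →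
           Γ ⨾ Δ ⊢ A ⊗ B ＠ w
    ⊗E   : ∀ {m k} {Γ Δ Δ₁ Δ₂ : Ctx m k} {A B C w w'} →
           Γ ⨾ Δ₁ ⊢ A ⊗ B ＠ w → Γ ⨾ (A , w) ∷ (B , w) ∷ Δ₂ ⊢ C ＠ w' →
           Δ ↭ Δ₁ ++ Δ₂ → Γ ⨾ Δ ⊢ C ＠ w'
    𝟏I   : ∀ {m k} {Γ : Ctx m k} {w} →
           Γ ⨾ [] ⊢ 𝟏 ＠ w
    𝟏E   : ∀ {m k} {Γ Δ Δ₁ Δ₂ : Ctx m k} {C w w'} →
           Γ ⨾ Δ₁ ⊢ 𝟏 ＠ w → Γ ⨾ Δ₂ ⊢ C ＠ w' → Δ ↭ Δ₁ ++ Δ₂ →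
           Γ ⨾ Δ ⊢ C ＠ w'
    ⊸I   : ∀ {m k} {Γ Δ : Ctx m k} {A B w} →
           Γ ⨾ (A , w) ∷ Δ ⊢ B ＠ w → Γ ⨾ Δ ⊢ A ⊸ B ＠ w
    ⊸E   : ∀ {m k} {Γ Δ Δ₁ Δ₂ : Ctx m k} {A B w} →
           Γ ⨾ Δ₁ ⊢ A ⊸ B ＠ w → Γ ⨾ Δ₂ ⊢ A ＠ w → Δ ↭ Δ₁ ++ Δ₂ →
           Γ ⨾ Δ ⊢ B ＠ w
    &I   : ∀ {m k} {Γ Δ : Ctx m k} {A B w} →
           Γ ⨾ Δ ⊢ A ＠ w → Γ ⨾ Δ ⊢ B ＠ w → Γ ⨾ Δ ⊢ A & B ＠ w
    &E₁  : ∀ {m k} {Γ Δ : Ctx m k} {A B w} →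
           Γ ⨾ Δ ⊢ A & B ＠ w → Γ ⨾ Δ ⊢ A ＠ w
    &E₂  : ∀ {m k} {Γ Δ : Ctx m k} {A B w} →
           Γ ⨾ Δ ⊢ A & B ＠ w → Γ ⨾ Δ ⊢ B ＠ w
    ⊕I₁  : ∀ {m k} {Γ Δ : Ctx m k} {A B w} →
           Γ ⨾ Δ ⊢ A ＠ w → Γ ⨾ Δ ⊢ A ⊕ B ＠ w
    ⊕I₂  : ∀ {m k} {Γ Δ : Ctx m k} {A B w} →
           Γ ⨾ Δ ⊢ B ＠ w → Γ ⨾ Δ ⊢ A ⊕ B ＠ w
    ⊕E   : ∀ {m k} {Γ Δ Δ₁ Δ₂ : Ctx m k} {A B C w w'} →
           Γ ⨾ Δ₁ ⊢ A ⊕ B ＠ w → Γ ⨾ (A , w) ∷ Δ₂ ⊢ C ＠ w' →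
           Γ ⨾ (B , w) ∷ Δ₂ ⊢ C ＠ w' → Δ ↭ Δ₁ ++ Δ₂ → Γ ⨾ Δ ⊢ C ＠ w'
    ⊤I   : ∀ {m k} {Γ Δ : Ctx m k} {w} →
           Γ ⨾ Δ ⊢ ⊤ ＠ w
    𝟎E   : ∀ {m k} {Γ Δ Δ₁ Δ₂ : Ctx m k} {C w w'} →
           Γ ⨾ Δ₁ ⊢ 𝟎 ＠ w → Δ ↭ Δ₁ ++ Δ₂ → Γ ⨾ Δ ⊢ C ＠ w'
    -- term quantifiers (freshness of the eigenvariable = weakening of the scope)
    ∀tI  : ∀ {m k} {Γ Δ : Ctx m k} {A : Prop (suc m) k} {w} →
           map wkJT Γ ⨾ map wkJT Δ ⊢ A ＠ w → Γ ⨾ Δ ⊢ ∀t A ＠ w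
    ∀tE  : ∀ {m k} {Γ Δ : Ctx m k} {A : Prop (suc m) k} {w} (τ : Tm m) →
           Γ ⨾ Δ ⊢ ∀t A ＠ w → Γ ⨾ Δ ⊢ A [ τ ]T ＠ w
    ∃tI  : ∀ {m k} {Γ Δ : Ctx m k} {A : Prop (suc m) k} {w} (τ : Tm m) →
           Γ ⨾ Δ ⊢ A [ τ ]T ＠ w → Γ ⨾ Δ ⊢ ∃t A ＠ w
    ∃tE  : ∀ {m k} {Γ Δ Δ₁ Δ₂ : Ctx m k} {A : Prop (suc m) k} {C w w'} →
           Γ ⨾ Δ₁ ⊢ ∃t A ＠ w →
           map wkJT Γ ⨾ (A , w) ∷ map wkJT Δ₂ ⊢ wkPT C ＠ w' →
           Δ ↭ Δ₁ ++ Δ₂ → Γ ⨾ Δ ⊢ C ＠ w'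
    ∀wI  : ∀ {m k} {Γ Δ : Ctx m k} {A : Prop m (suc k)} {w} →
           map wkJW Γ ⨾ map wkJW Δ ⊢ A ＠ wkW w → Γ ⨾ Δ ⊢ ∀w A ＠ w
    ∀wE  : ∀ {m k} {Γ Δ : Ctx m k} {A : Prop m (suc k)} {w} (τ : Wld k) →
           Γ ⨾ Δ ⊢ ∀w A ＠ w → Γ ⨾ Δ ⊢ A [ τ ]W ＠ w
    ∃wI  : ∀ {m k} {Γ Δ : Ctx m k} {A : Prop m (suc k)} {w} (τ : Wld k) →
           Γ ⨾ Δ ⊢ A [ τ ]W ＠ w → Γ ⨾ Δ ⊢ ∃w A ＠ w
    ∃wE  : ∀ {m k} {Γ Δ Δ₁ Δ₂ : Ctx m k} {A : Prop m (suc k)} {C w w'} →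
           Γ ⨾ Δ₁ ⊢ ∃w A ＠ w →
           map wkJW Γ ⨾ (A , wkW w) ∷ map wkJW Δ₂ ⊢ wkPW C ＠ wkW w' →
           Δ ↭ Δ₁ ++ Δ₂ → Γ ⨾ Δ ⊢ C ＠ w'
    !I   : ∀ {m k} {Γ : Ctx m k} {A w} →
           Γ ⨾ [] ⊢ A ＠ w → Γ ⨾ [] ⊢ ! A ＠ w
    !E   : ∀ {m k} {Γ Δ Δ₁ Δ₂ : Ctx m k} {A C w w'} →
           Γ ⨾ Δ₁ ⊢ ! A ＠ w → (A , w) ∷ Γ ⨾ Δ₂ ⊢ C ＠ w' →
           Δ ↭ Δ₁ ++ Δ₂ → Γ ⨾ Δ ⊢ C ＠ w'
    atI  : ∀ {m k} {Γ Δ : Ctx m k} {A w w'} →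
           Γ ⨾ Δ ⊢ A ＠ w → Γ ⨾ Δ ⊢ A at w ＠ w'
    atE  : ∀ {m k} {Γ Δ : Ctx m k} {A w w'} →
           Γ ⨾ Δ ⊢ A at w ＠ w' → Γ ⨾ Δ ⊢ A ＠ w
    ↓I   : ∀ {m k} {Γ Δ : Ctx m k} {A : Prop m (suc k)} {w} →
           Γ ⨾ Δ ⊢ A [ w ]W ＠ w → Γ ⨾ Δ ⊢ ↓ A ＠ w
    ↓E   : ∀ {m k} {Γ Δ : Ctx m k} {A : Prop m (suc k)} {w} →
           Γ ⨾ Δ ⊢ ↓ A ＠ w → Γ ⨾ Δ ⊢ A [ w ]W ＠ w

-- Both principles are derivable, not merely admissible: the calculus
-- already contains elimination rules that discharge a hypothesis A@u
-- while concluding a judgement at an unrelated world w.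
--
-- * Linear substitution.  From Γ;Δ ⊢ A@u, the rule ⊕I₁ gives
--   Γ;Δ ⊢ A ⊕ A@u.  Then ⊕E, using the derivation of C@w from A@u for
--   both branches, yields Γ;Δ,Δ' ⊢ C@w.
-- * Unrestricted substitution.  From Γ;· ⊢ A@u, the rule !I gives
--   Γ;· ⊢ !A@u.  Then !E moves A@u into the unrestricted context of the
--   second derivation, yielding Γ;Δ ⊢ C@w.
--
-- Each lemma is stated for any linear context that is a permutation of
-- the combined one, since multisets are lists up to _↭_.  The main
-- theorem instantiates the permutation with reflexivity.
module Submission where

open import Defs
open import Level using (Level)
open import Data.List using (List; []; _∷_; _++_)
open import Data.Product using (_×_; _,_)
open import Algebra.Bundles using (Monoid)
open import Data.List.Relation.Binary.Permutation.Propositional using (_↭_; ↭-refl)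

module Cut {c ℓ : Level} (𝒲 : Monoid c ℓ) (Sig : Signature) where
  open HyLL 𝒲 Sig

  -- The detour is ⊕I₁ then ⊕E, whose branches may conclude at any world.
  linear-cut : ∀ {m k} {Γ Δ Δ' Δ'' : Ctx m k} {A C : Prop m k} {u w : Wld k} →
    Γ ⨾ Δ ⊢ A ＠ u → Γ ⨾ (A , u) ∷ Δ' ⊢ C ＠ w → Δ'' ↭ Δ ++ Δ' →
    Γ ⨾ Δ'' ⊢ C ＠ w
  linear-cut {A = A} d e perm = ⊕E (⊕I₁ {B = A} d) e e perm

  -- Cut for an unrestricted hypothesis: a proof of A@u from no linear
  -- resources may replace the unrestricted hypothesis A@u.
  -- The detour is !I then !E, which moves A@u into Γ.
  unrestricted-cut : ∀ {m k} {Γ Δ Δ' : Ctx m k} {A C : Prop m k} {u w : Wld k} →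
    Γ ⨾ [] ⊢ A ＠ u → (A , u) ∷ Γ ⨾ Δ ⊢ C ＠ w → Δ' ↭ Δ →
    Γ ⨾ Δ' ⊢ C ＠ w
  unrestricted-cut d e perm = !E (!I d) e perm

mainTheorem2 : ∀ {c ℓ : Level} (𝒲 : Monoid c ℓ) (Sig : Signature) →
    let open HyLL 𝒲 Sig in
      (∀ {m k} {Γ Δ Δ' : Ctx m k} {A C : Prop m k} {u w : Wld k} →
         Γ ⨾ Δ ⊢ A ＠ u → Γ ⨾ (A , u) ∷ Δ' ⊢ C ＠ w → Γ ⨾ Δ ++ Δ' ⊢ C ＠ w)
      ×
      (∀ {m k} {Γ Δ : Ctx m k} {A C : Prop m k} {u w : Wld k} →
         Γ ⨾ [] ⊢ A ＠ u → (A , u) ∷ Γ ⨾ Δ ⊢ C ＠ w → Γ ⨾ Δ ⊢ C ＠ w)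
mainTheorem2 𝒲 Sig =
    (λ d e → linear-cut d e ↭-refl)
  , (λ d e → unrestricted-cut d e ↭-refl)
  where open Cut 𝒲 Sig
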